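{- Let $\mathcal{M}_1\models T_1$ with universe $M$ and let $\mathcal{M}_2$ be obtained from $\mathcal{M}_1$ as in the context; write $f=f^{\mathcal{M}_2}$. Then there are finitely many constant (closed) $\mathcal{L}_1$-terms $\tau_1,\dots,\tau_k$ such that $f(S(x))=S(f(x))$ for every $x\in M\setminus\{\tau_1^{\mathcal{M}_2},\dots,\tau_k^{\mathcal{M}_2}\}$.
   Context: For a linear order $<$ write $C_<(a,b,c)$ iff $(a<b<c)\lor(b<c<a)\lor(c<a<b)$, and $C_<(a,-,b)=\{x: C_<(a,x,b)\}$. For a language $\mathcal{L}\ni<$, $T^{omin}_{\mathcal{L}}$ is the set of $\mathcal{L}$-sentences true in every o-minimal $\mathcal{L}$-structure. Let $\mathcal{L}_0=\{<,Z,S,P,\pi,c_1,c_2,c_3,c_4\}$ ($<$ binary relation, $Z$ unary predicate, $S,P,\pi$ unary function symbols, $c_i$ constants). $T_0$ is the $\mathcal{L}_0$-theory: (1) $T^{omin}_{\mathcal{L}_0}$; (2) $<$ is a dense linear order without endpoints; (3) every non-maximal (non-minimal) element of $Z$ has an immediate successor (predecessor) in $Z$; (4) every $x\notin Z$ lies in an open interval disjoint from $Z$; (5) $\min Z=c_1$, $\max Z=c_4$; (6) $c_2,c_3\in Z$, $c_1<c_2<c_3<c_4$, and there are infinitely many elements of $Z$ between any two of $c_1,\dots,c_4$; (7) for all $x$: $\pi(x)\in Z$ and there is no $y\in Z$ with $C_<(x,y,\pi(x))$; (8) $S(x)=y$ iff $(x\notin Z\land x=y)\lor(x\in Z\land y\in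 Z\land\neg\exists z\in Z\,C_<(x,z,y))$, and $P=S^{ -1}$. Let $\mathcal{L}_1=\mathcal{L}_0\cup\{f,g\}$ with $f,g$ unary function symbols; $T_1$ is $T_0$ together with: (9) $f$ is bijective and $g=f^{ -1}$; (10) $f$ maps $Z\cap[c_1,c_2]$ onto $Z\cap[c_3,c_4]$ order-preservingly; (11) $f$ maps $Z\cap(c_2,c_4]$ onto $Z\cap[c_1,c_3)$ order-preservingly; (12) for all $n>1$ and $z\in Z$, both $Z\cap C_<(z,-,f^n(z))$ and $Z\cap C_<(f^n(z),-,z)$ are infinite; (13) $f(x)=x$ for $x\notin Z$; (14) $C_<(f^m(z),f^n(z),z)$ for all $m>n>0$ and $z\in Z$. Given $\mathcal{M}_1\models T_1$ with universe $M$, $\mathcal{M}_2$ is the $\mathcal{L}_1$-structure with universe $M$ agreeing with $\mathcal{M}_1$ on all symbols except: $f^{\mathcal{M}_2}(x)=P(f^{\mathcal{M}_1}(x))$ if $S^n(x)=c_4$ for some $n\in\mathbb{N}$ (with $S^0=\mathrm{id}$), and $f^{\mathcal{M}_2}(x)=f^{\mathcal{M}_1}(x)$ otherwise; $g^{\mathcal{M}_2}(x)=g^{\mathcal{M}_1}(S(x))$ if $S^n(x)=P(c_3)$ for some $n\in\mathbb{N}$, and $g^{\mathcal{M}_2}(x)=g^{\mathcal{M}_1}(x)$ otherwise. -}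

module Defs where

open import Level using (0ℓ)
open import Data.Nat using (ℕ; zero; suc) renaming (_<_ to _<ℕ_)
open import Data.Fin using (Fin; zero; suc) renaming (_<_ to _<ᶠ_)
open import Data.Maybe using (Maybe; just; nothing)
open import Data.List using (List)
open import Data.List.Relation.Unary.Any using (Any)
open import Data.Product using (Σ; _×_; _,_)
open import Data.Sum using (_⊎_)
open import Data.Empty using (⊥)
open import Data.Unit using (⊤)
open import Relation.Nullary using (¬_; yes; no)
open import Relation.Binary.PropositionalEquality using (_≡_; _≢_)
open import Axiom.ExcludedMiddle using (ExcludedMiddle)

-- Every language considered here consists of the binary
-- relation <, the unary predicate Z, four constants c₁..c₄ (indexed by
-- Fin 4: zero ↦ c₁, …, 3 ↦ c₄) and a type F of unary function symbols.

data Sym₀ : Set where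
  sS sP sπ : Sym₀

data Sym₁ : Set where
  old : Sym₀ → Sym₁
  sf sg : Sym₁

record Structure (F : Set) : Set₁ where
  field
    Carrier : Set
    _≺_     : Carrier → Carrier → Set
    Zₛ      : Carrier → Set
    cₛ      : Fin 4 → Carrier
    fnₛ     : F → Carrier → Carrier

open Structure public

reduct : Structure Sym₁ → Structure Sym₀
reduct M = record
  { Carrier = Carrier M ; _≺_ = _≺_ M ; Zₛ = Zₛ M ; cₛ = cₛ M
  ; fnₛ = λ s → fnₛ M (old s) }

data Term (F : Set) (n : ℕ) : Set where
  var : Fin n → Term F n
  con : Fin 4 → Term F n
  app : F → Term F n → Term F n

data Formula (F : Set) : ℕ → Set where
  _≐_ _≺′_ : ∀ {n} → Term F n → Term F n → Formula F n
  isZ      : ∀ {n} → Term F n → Formula F n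
  ⊥′       : ∀ {n} → Formula F n
  _⇒_ _∧′_ _∨′_ : ∀ {n} → Formula F n → Formula F n → Formula F n
  ∀′ ∃′    : ∀ {n} → Formula F (suc n) → Formula F n

Sentence : Set → Set
Sentence F = Formula F 0

ClosedTerm : Set → Set
ClosedTerm F = Term F 0

ext : ∀ {A : Set} {n} → A → (Fin n → A) → Fin (suc n) → A
ext a ρ zero    = a
ext a ρ (suc i) = ρ i

module _ {F : Set} (M : Structure F) where
  evalT : ∀ {n} → Term F n → (Fin n → Carrier M) → Carrier M
  evalT (var i)   ρ = ρ i
  evalT (con i)   ρ = cₛ M i
  evalT (app s t) ρ = fnₛ M s (evalT t ρ)

  -- Tarski satisfaction (read classically: the theorem assumes LEM)
  sat : ∀ {n} → Formula F n → (Fin n → Carrier M) → Set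
  sat (t ≐ u)   ρ = evalT t ρ ≡ evalT u ρ
  sat (t ≺′ u)  ρ = _≺_ M (evalT t ρ) (evalT u ρ)
  sat (isZ t)   ρ = Zₛ M (evalT t ρ)
  sat ⊥′        ρ = ⊥
  sat (φ ⇒ ψ)   ρ = sat φ ρ → sat ψ ρ
  sat (φ ∧′ ψ)  ρ = sat φ ρ × sat ψ ρ
  sat (φ ∨′ ψ)  ρ = sat φ ρ ⊎ sat ψ ρ
  sat (∀′ φ)    ρ = (a : Carrier M) → sat φ (ext a ρ)
  sat (∃′ φ)    ρ = Σ (Carrier M) λ a → sat φ (ext a ρ)

  _⊨_ : Sentence F → Set
  _⊨_ φ = sat φ (λ ())

  evalClosed : ClosedTerm F → Carrier M
  evalClosed t = evalT t (λ ())

-- pieces of a finite union: points, and open intervals (lo , hi) with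
-- lo ∈ M ∪ {-∞} (nothing = -∞) and hi ∈ M ∪ {+∞} (nothing = +∞)
data Piece (A : Set) : Set where
  point    : A → Piece A
  interval : Maybe A → Maybe A → Piece A

module _ {F : Set} (M : Structure F) where
  private
    A = Carrier M
    _<_ = _≺_ M

  above : Maybe A → A → Set
  above nothing  x = ⊤
  above (just a) x = a < x

  below : Maybe A → A → Set
  below nothing  x = ⊤
  below (just b) x = x < b

  InPiece : A → Piece A → Set
  InPiece x (point a)         = x ≡ a
  InPiece x (interval lo hi)  = above lo x × below hi x

  record OMinimal : Set where
    field
      irrefl  : ∀ x → ¬ (x < x)
      trans   : ∀ x y z → x < y → y < z → x < z
      total   : ∀ x y → x < y ⊎ x ≡ y ⊎ y < x
      definable : ∀ {n} (φ : Formula F (suc n)) (ā : Fin n → A) →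
        Σ (List (Piece A)) λ ps → ∀ x →
          (sat M φ (ext x ā) → Any (InPiece x) ps) ×
          (Any (InPiece x) ps → sat M φ (ext x ā))

TOmin : (F : Set) → Sentence F → Set₁
TOmin F φ = (N : Structure F) → OMinimal N → N ⊨ φ

iter : ∀ {A : Set} → (A → A) → ℕ → A → A
iter h zero    x = x
iter h (suc n) x = h (iter h n x)

Cyc : ∀ {A : Set} → (A → A → Set) → A → A → A → Set
Cyc _<_ a b c = (a < b × b < c) ⊎ (b < c × c < a) ⊎ (c < a × a < b)

Infinite : ∀ {A : Set} → (A → Set) → Set
Infinite {A} X = ∀ k → Σ (Fin k → A) λ v →
  (∀ i → X (v i)) × (∀ i j → v i ≡ v j → i ≡ j)

module _ (M : Structure Sym₁) where
  private
    A = Carrier M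
    _<_ = _≺_ M
    _≤_ : A → A → Set
    x ≤ y = x < y ⊎ x ≡ y
    Z = Zₛ M
    S = fnₛ M (old sS)
    P = fnₛ M (old sP)
    π = fnₛ M (old sπ)
    f = fnₛ M sf
    g = fnₛ M sg
    c = cₛ M
    c₁ = c zero
    c₂ = c (suc zero)
    c₃ = c (suc (suc zero))
    c₄ = c (suc (suc (suc zero)))
    C = Cyc _<_

  record ModelT₁ : Set₁ where
    field
      ax1  : (φ : Sentence Sym₀) → TOmin Sym₀ φ → reduct M ⊨ φ
      ax2-irrefl : ∀ x → ¬ (x < x)
      ax2-trans  : ∀ x y z → x < y → y < z → x < z
      ax2-total  : ∀ x y → x < y ⊎ x ≡ y ⊎ y < x
      ax2-dense  : ∀ x y → x < y → Σ A λ z → x < z × z < y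
      ax2-noMax  : ∀ x → Σ A λ y → x < y
      ax2-noMin  : ∀ x → Σ A λ y → y < x
      ax3-succ : ∀ x → Z x → (Σ A λ y → Z y × x < y) →
        Σ A λ y → Z y × x < y × ¬ (Σ A λ w → Z w × x < w × w < y)
      ax3-pred : ∀ x → Z x → (Σ A λ y → Z y × y < x) →
        Σ A λ y → Z y × y < x × ¬ (Σ A λ w → Z w × y < w × w < x)
      ax4 : ∀ x → ¬ Z x → Σ A λ a → Σ A λ b → a < x × x < b ×
              (∀ w → a < w → w < b → ¬ Z w)
      ax5-min : Z c₁ × (∀ z → Z z → c₁ ≤ z)
      ax5-max : Z c₄ × (∀ z → Z z → z ≤ c₄)
      ax6-Z   : Z c₂ × Z c₃
      ax6-ord : c₁ < c₂ × c₂ < c₃ × c₃ < c₄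
      ax6-inf : ∀ (i j : Fin 4) → i <ᶠ j →
                  Infinite (λ z → Z z × c i < z × z < c j)
      ax7 : ∀ x → Z (π x) × ¬ (Σ A λ y → Z y × C x y (π x))
      -- (8)  (y ≢ x added in the Z-case)
      ax8 : ∀ x y →
        (S x ≡ y → (¬ Z x × x ≡ y) ⊎
                   (Z x × Z y × y ≢ x × ¬ (Σ A λ z → Z z × C x z y))) ×
        ((¬ Z x × x ≡ y) ⊎
         (Z x × Z y × y ≢ x × ¬ (Σ A λ z → Z z × C x z y)) → S x ≡ y)
      ax8-P : ∀ x → P (S x) ≡ x × S (P x) ≡ x
      ax9 : ∀ x → g (f x) ≡ x × f (g x) ≡ x
      ax10-into : ∀ x → Z x → c₁ ≤ x → x ≤ c₂ → Z (f x) × c₃ ≤ f x × f x ≤ c₄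
      ax10-onto : ∀ y → Z y → c₃ ≤ y → y ≤ c₄ →
                    Σ A λ x → Z x × c₁ ≤ x × x ≤ c₂ × f x ≡ y
      ax10-mono : ∀ x x′ → Z x → c₁ ≤ x → x ≤ c₂ → Z x′ → c₁ ≤ x′ → x′ ≤ c₂ →
                    x < x′ → f x < f x′
      ax11-into : ∀ x → Z x → c₂ < x → x ≤ c₄ → Z (f x) × c₁ ≤ f x × f x < c₃
      ax11-onto : ∀ y → Z y → c₁ ≤ y → y < c₃ →
                    Σ A λ x → Z x × c₂ < x × x ≤ c₄ × f x ≡ y
      ax11-mono : ∀ x x′ → Z x → c₂ < x → x ≤ c₄ → Z x′ → c₂ < x′ → x′ ≤ c₄ →
                    x < x′ → f x < f x′
      ax12 : ∀ n → 1 <ℕ n → ∀ z → Z z →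
        Infinite (λ y → Z y × C z y (iter f n z)) ×
        Infinite (λ y → Z y × C (iter f n z) y z)
      ax13 : ∀ x → ¬ Z x → f x ≡ x
      ax14 : ∀ m n → n <ℕ m → 0 <ℕ n → ∀ z → Z z →
        C (iter f m z) (iter f n z) z

module _ (lem : ExcludedMiddle 0ℓ) (M : Structure Sym₁) where
  private
    A = Carrier M
    S = fnₛ M (old sS)
    P = fnₛ M (old sP)
    f = fnₛ M sf
    g = fnₛ M sg
    c₃ = cₛ M (suc (suc zero))
    c₄ = cₛ M (suc (suc (suc zero)))

  f₂ : A → A
  f₂ x with lem {Σ ℕ λ n → iter S n x ≡ c₄}
  ... | yes _ = P (f x)
  ... | no  _ = f x

  g₂ : A → A
  g₂ x with lem {Σ ℕ λ n → iter S n x ≡ P c₃}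
  ... | yes _ = g (S x)
  ... | no  _ = g x

  M₂ : Structure Sym₁
  M₂ = record
    { Carrier = A ; _≺_ = _≺_ M ; Zₛ = Zₛ M ; cₛ = cₛ M
    ; fnₛ = λ { (old s) → fnₛ M (old s) ; sf → f₂ ; sg → g₂ } }

-- On Z, f maps Z ∩ [c₁,c₂] and Z ∩ (c₂,c₄] order-isomorphically onto the
-- convex pieces Z ∩ [c₃,c₄] and Z ∩ [c₁,c₃), and such an isomorphism sends
-- immediate successors to immediate successors; at the seam, f (S c₂) = c₁ = S c₄
-- = S (f c₂).  Off Z both f and S are the identity.  So f commutes with S away
-- from c₄.  M₂ replaces f by P ∘ f exactly on the points whose S-orbit reaches
-- c₄, a set that contains x iff it contains S x when x ≠ c₄, and P ∘ f commutes
-- with S wherever f does.  Hence the single closed term c₄ suffices.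

module Submission where

open import Defs
open import Level using (0ℓ)
open import Function using (_∘_)
open import Data.Product using (Σ; _×_; _,_; proj₁; proj₂)
open import Data.Sum using (_⊎_; inj₁; inj₂)
open import Data.Nat using (ℕ; zero; suc)
open import Data.Fin using (zero; suc)
open import Data.Empty using (⊥-elim)
open import Data.List using (List; map; _∷_; [])
open import Data.List.Membership.Propositional using (_∉_)
open import Data.List.Relation.Unary.Any using (here)
open import Relation.Nullary using (¬_; Dec; yes; no)
open import Relation.Binary.PropositionalEquality
  using (_≡_; _≢_; refl; sym; trans; cong; subst; module ≡-Reasoning)
open import Axiom.ExcludedMiddle using (ExcludedMiddle)

iter-suc : ∀ {A : Set} (h : A → A) n x → iter h n (h x) ≡ iter h (suc n) x
iter-suc h zero    x = refl
iter-suc h (suc n) x = cong h (iter-suc h n x)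

module _ (M : Structure Sym₁) (T : ModelT₁ M) where
  open ModelT₁ T

  private
    A : Set
    A = Carrier M
    _<_ : A → A → Set
    _<_ = _≺_ M
    Z : A → Set
    Z = Zₛ M
    S P f : A → A
    S = fnₛ M (old sS)
    P = fnₛ M (old sP)
    f = fnₛ M sf
    c₁ c₂ c₃ c₄ : A
    c₁ = cₛ M zero
    c₂ = cₛ M (suc zero)
    c₃ = cₛ M (suc (suc zero))
    c₄ = cₛ M (suc (suc (suc zero)))

  _≤_ : A → A → Set
  x ≤ y = x < y ⊎ x ≡ y

  <-trans : ∀ {x y z} → x < y → y < z → x < z
  <-trans = ax2-trans _ _ _

  <-irrefl : ∀ {x y} → x ≡ y → ¬ (x < y)
  <-irrefl {x} refl = ax2-irrefl x

  <-asym : ∀ {x y} → x < y → ¬ (y < x)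
  <-asym x<y y<x = <-irrefl refl (<-trans x<y y<x)

  ≤-<-trans : ∀ {x y z} → x ≤ y → y < z → x < z
  ≤-<-trans (inj₁ x<y) y<z = <-trans x<y y<z
  ≤-<-trans (inj₂ refl) y<z = y<z

  <-≤-trans : ∀ {x y z} → x < y → y ≤ z → x < z
  <-≤-trans x<y (inj₁ y<z) = <-trans x<y y<z
  <-≤-trans x<y (inj₂ refl) = x<y

  ≤⇒≯ : ∀ {x y} → x ≤ y → ¬ (y < x)
  ≤⇒≯ (inj₁ x<y) = <-asym x<y
  ≤⇒≯ (inj₂ refl) = <-irrefl refl

  Cyc-between : ∀ {x y z} → x < z → Cyc _<_ x y z → x < y × y < z
  Cyc-between x<z (inj₁ x<y<z) = x<y<z
  Cyc-between x<z (inj₂ (inj₁ (_ , z<x))) = ⊥-elim (<-asym x<z z<x)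
  Cyc-between x<z (inj₂ (inj₂ (z<x , _))) = ⊥-elim (<-asym x<z z<x)

  c₁≤ : ∀ {x} → Z x → c₁ ≤ x
  c₁≤ zx = proj₂ ax5-min _ zx

  ≤c₄ : ∀ {x} → Z x → x ≤ c₄
  ≤c₄ zx = proj₂ ax5-max _ zx

  c₁<c₃ : c₁ < c₃
  c₁<c₃ = <-trans (proj₁ ax6-ord) (proj₁ (proj₂ ax6-ord))

  c₂<c₄ : c₂ < c₄
  c₂<c₄ = <-trans (proj₁ (proj₂ ax6-ord)) (proj₂ (proj₂ ax6-ord))

  Gap : A → A → Set
  Gap x y = ¬ (Σ A λ z → Z z × x < z × z < y)

  S-nonZ : ∀ {x} → ¬ Z x → S x ≡ x
  S-nonZ nzx = proj₂ (ax8 _ _) (inj₁ (nzx , refl))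

  S-spec : ∀ {x} → Z x → Z (S x) × S x ≢ x × ¬ (Σ A λ z → Z z × Cyc _<_ x z (S x))
  S-spec {x} zx with proj₁ (ax8 x (S x)) refl
  ... | inj₁ (nzx , _) = ⊥-elim (nzx zx)
  ... | inj₂ (_ , spec) = spec

  S-Z : ∀ {x} → Z x → Z (S x)
  S-Z zx = proj₁ (S-spec zx)

  S-gap : ∀ {x} → Z x → Gap x (S x)
  S-gap zx (z , zz , x<z<Sx) = proj₂ (proj₂ (S-spec zx)) (z , zz , inj₁ x<z<Sx)

  S-unique : ∀ {x y} → Z x → Z y → x < y → Gap x y → S x ≡ y
  S-unique zx zy x<y gap = proj₂ (ax8 _ _) (inj₂ (zx , zy , y≢x , no-cyclic))
    where
    y≢x = λ y≡x → <-irrefl (sym y≡x) x<y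
    no-cyclic = λ { (z , zz , c) → gap (z , zz , Cyc-between x<y c) }

  <-S : ∀ {x} → Z x → x ≢ c₄ → x < S x
  <-S {x} zx x≢c₄ with ax2-total x (S x) | ≤c₄ zx
  ... | inj₁ x<Sx          | _ = x<Sx
  ... | inj₂ (inj₁ x≡Sx)   | _ = ⊥-elim (proj₁ (proj₂ (S-spec zx)) (sym x≡Sx))
  ... | inj₂ (inj₂ _)      | inj₂ x≡c₄ = ⊥-elim (x≢c₄ x≡c₄)
  ... | inj₂ (inj₂ Sx<x)   | inj₁ x<c₄ =
    ⊥-elim (proj₂ (proj₂ (S-spec zx)) (c₄ , proj₁ ax5-max , inj₂ (inj₂ (Sx<x , x<c₄))))

  S-least : ∀ {x y} → Z x → Z y → x < y → S x ≤ y
  S-least {x} {y} zx zy x<y with ax2-total (S x) y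
  ... | inj₁ Sx<y         = inj₁ Sx<y
  ... | inj₂ (inj₁ Sx≡y)  = inj₂ Sx≡y
  ... | inj₂ (inj₂ y<Sx)  = ⊥-elim (S-gap zx (y , zy , x<y , y<Sx))

  S-c₄ : S c₄ ≡ c₁
  S-c₄ = proj₂ (ax8 _ _) (inj₂ (proj₁ ax5-max , proj₁ ax5-min , c₁≢c₄ , no-cyclic))
    where
    c₁≢c₄ = λ c₁≡c₄ → <-irrefl c₁≡c₄ (<-trans c₁<c₃ (proj₂ (proj₂ ax6-ord)))
    no-cyclic : ¬ (Σ A λ z → Z z × Cyc _<_ c₄ z c₁)
    no-cyclic (z , zz , inj₁ (c₄<z , _))        = ≤⇒≯ (≤c₄ zz) c₄<z
    no-cyclic (z , zz , inj₂ (inj₁ (z<c₁ , _))) = ≤⇒≯ (c₁≤ zz) z<c₁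
    no-cyclic (z , zz , inj₂ (inj₂ (_ , c₄<z))) = ≤⇒≯ (≤c₄ zz) c₄<z

  Icc Ioc Ico : A → A → A → Set
  Icc a b x = a ≤ x × x ≤ b
  Ioc a b x = a < x × x ≤ b
  Ico a b x = a ≤ x × x < b

  Convex : (A → Set) → Set
  Convex I = ∀ {p q z} → I p → I q → p < z → z < q → I z

  Icc-convex : ∀ {a b} → Convex (Icc a b)
  Icc-convex (a≤p , _) (_ , q≤b) p<z z<q =
    inj₁ (≤-<-trans a≤p p<z) , inj₁ (<-≤-trans z<q q≤b)

  Ico-convex : ∀ {a b} → Convex (Ico a b)
  Ico-convex (a≤p , _) (_ , q<b) p<z z<q = inj₁ (≤-<-trans a≤p p<z) , <-trans z<q q<b

  record PieceIso (h : A → A) (R I : A → Set) : Set where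
    field
      maps-into : ∀ {a} → Z a → R a → Z (h a) × I (h a)
      maps-onto : ∀ {b} → Z b → I b → Σ A λ a → Z a × R a × h a ≡ b
      monotone  : ∀ {a b} → Z a → R a → Z b → R b → a < b → h a < h b
      convex    : Convex I

    reflects-< : ∀ {a b} → Z a → R a → Z b → R b → h a < h b → a < b
    reflects-< {a} {b} za ra zb rb ha<hb with ax2-total a b
    ... | inj₁ a<b         = a<b
    ... | inj₂ (inj₁ refl) = ⊥-elim (<-irrefl refl ha<hb)
    ... | inj₂ (inj₂ b<a)  = ⊥-elim (<-asym ha<hb (monotone zb rb za ra b<a))

    S-comm : ∀ {x} → Z x → R x → R (S x) → x < S x → h (S x) ≡ S (h x)
    S-comm {x} zx rx rSx x<Sx =
      sym (S-unique (proj₁ (maps-into zx rx)) (proj₁ (maps-into zSx rSx)) hx<hSx gap)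
      where
      zSx = S-Z zx
      hx<hSx = monotone zx rx zSx rSx x<Sx
      gap : Gap (h x) (h (S x))
      gap (z , zz , hx<z , z<hSx)
        with maps-onto zz (convex (proj₂ (maps-into zx rx)) (proj₂ (maps-into zSx rSx)) hx<z z<hSx)
      ... | a , za , ra , refl =
        S-gap zx (a , za , reflects-< zx rx za ra hx<z , reflects-< za ra zSx rSx z<hSx)

    maps-max : ∀ {m n} → Z m → R m → (∀ {a} → Z a → R a → a ≤ m) →
               Z n → I n → (∀ {b} → Z b → I b → b ≤ n) → h m ≡ n
    maps-max zm rm m-max zn In n-max with maps-onto zn In
    ... | a , za , ra , ha≡n with m-max za ra
    ...   | inj₂ refl = ha≡n
    ...   | inj₁ a<m  = ⊥-elim (≤⇒≯ (n-max zhm Ihm) (subst (_< h _) ha≡n (monotone za ra zm rm a<m)))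
      where
      zhm = proj₁ (maps-into zm rm)
      Ihm = proj₂ (maps-into zm rm)

    maps-min : ∀ {m n} → Z m → R m → (∀ {a} → Z a → R a → m ≤ a) →
               Z n → I n → (∀ {b} → Z b → I b → n ≤ b) → h m ≡ n
    maps-min zm rm m-min zn In n-min with maps-onto zn In
    ... | a , za , ra , ha≡n with m-min za ra
    ...   | inj₂ refl = ha≡n
    ...   | inj₁ m<a  = ⊥-elim (≤⇒≯ (n-min zhm Ihm) (subst (h _ <_) ha≡n (monotone zm rm za ra m<a)))
      where
      zhm = proj₁ (maps-into zm rm)
      Ihm = proj₂ (maps-into zm rm)

  lower-piece : PieceIso f (Icc c₁ c₂) (Icc c₃ c₄)
  lower-piece = record
    { maps-into = λ { za (p , q) → ax10-into _ za p q }
    ; maps-onto = λ { zb (p , q) → let (a , za , r , s , e) = ax10-onto _ zb p q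
                                   in a , za , (r , s) , e }
    ; monotone  = λ { za (p , q) zb (p′ , q′) → ax10-mono _ _ za p q zb p′ q′ }
    ; convex    = Icc-convex
    }

  upper-piece : PieceIso f (Ioc c₂ c₄) (Ico c₁ c₃)
  upper-piece = record
    { maps-into = λ { za (p , q) → ax11-into _ za p q }
    ; maps-onto = λ { zb (p , q) → let (a , za , r , s , e) = ax11-onto _ zb p q
                                   in a , za , (r , s) , e }
    ; monotone  = λ { za (p , q) zb (p′ , q′) → ax11-mono _ _ za p q zb p′ q′ }
    ; convex    = Ico-convex
    }

  f-c₂ : f c₂ ≡ c₄
  f-c₂ = PieceIso.maps-max lower-piece zc₂ (inj₁ (proj₁ ax6-ord) , inj₂ refl) (λ _ → proj₂)
           (proj₁ ax5-max) (inj₁ (proj₂ (proj₂ ax6-ord)) , inj₂ refl) (λ _ → proj₂)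
    where zc₂ = proj₁ ax6-Z

  f-S-c₂ : f (S c₂) ≡ c₁
  f-S-c₂ = PieceIso.maps-min upper-piece (S-Z zc₂) (c₂<Sc₂ , ≤c₄ (S-Z zc₂))
             (λ za → S-least zc₂ za ∘ proj₁)
             (proj₁ ax5-min) (inj₂ refl , c₁<c₃) (λ _ → proj₁)
    where
    zc₂ = proj₁ ax6-Z
    c₂<Sc₂ = <-S zc₂ (λ c₂≡c₄ → <-irrefl c₂≡c₄ c₂<c₄)

  f-S-comm-Z : ∀ {x} → Z x → x ≢ c₄ → f (S x) ≡ S (f x)
  f-S-comm-Z {x} zx x≢c₄ with ax2-total x c₂
  ... | inj₁ x<c₂ =
    PieceIso.S-comm lower-piece zx (c₁≤ zx , inj₁ x<c₂)
      (inj₁ (≤-<-trans (c₁≤ zx) x<Sx) , S-least zx (proj₁ ax6-Z) x<c₂) x<Sx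
    where x<Sx = <-S zx x≢c₄
  ... | inj₂ (inj₂ c₂<x) =
    PieceIso.S-comm upper-piece zx (c₂<x , ≤c₄ zx) (<-trans c₂<x x<Sx , ≤c₄ (S-Z zx)) x<Sx
    where x<Sx = <-S zx x≢c₄
  ... | inj₂ (inj₁ refl) = begin
    f (S c₂)  ≡⟨ f-S-c₂ ⟩
    c₁        ≡⟨ sym S-c₄ ⟩
    S c₄      ≡⟨ cong S (sym f-c₂) ⟩
    S (f c₂)  ∎
    where open ≡-Reasoning

  module _ (lem : ExcludedMiddle 0ℓ) where

    f-S-comm : ∀ {x} → x ≢ c₄ → f (S x) ≡ S (f x)
    f-S-comm {x} x≢c₄ with lem {Z x}
    ... | yes zx  = f-S-comm-Z zx x≢c₄
    ... | no nzx  = begin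
      f (S x)  ≡⟨ cong f (S-nonZ nzx) ⟩
      f x      ≡⟨ ax13 x nzx ⟩
      x        ≡⟨ sym (S-nonZ nzx) ⟩
      S x      ≡⟨ cong S (sym (ax13 x nzx)) ⟩
      S (f x)  ∎
      where open ≡-Reasoning

    ReachesC₄ : A → Set
    ReachesC₄ x = Σ ℕ λ n → iter S n x ≡ c₄

    reaches-S⇒reaches : ∀ {x} → ReachesC₄ (S x) → ReachesC₄ x
    reaches-S⇒reaches {x} (n , e) = suc n , trans (sym (iter-suc S n x)) e

    reaches⇒reaches-S : ∀ {x} → x ≢ c₄ → ReachesC₄ x → ReachesC₄ (S x)
    reaches⇒reaches-S x≢c₄ (zero , e)  = ⊥-elim (x≢c₄ e)
    reaches⇒reaches-S {x} _ (suc n , e) = n , trans (iter-suc S n x) e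

    f₂-reaching : ∀ {x} → ReachesC₄ x → f₂ lem M x ≡ P (f x)
    f₂-reaching {x} r with lem {ReachesC₄ x}
    ... | yes _ = refl
    ... | no ¬r = ⊥-elim (¬r r)

    f₂-nonreaching : ∀ {x} → ¬ ReachesC₄ x → f₂ lem M x ≡ f x
    f₂-nonreaching {x} ¬r with lem {ReachesC₄ x}
    ... | yes r = ⊥-elim (¬r r)
    ... | no _  = refl

    f₂-S-comm : ∀ {x} → x ≢ c₄ → f₂ lem M (S x) ≡ S (f₂ lem M x)
    f₂-S-comm {x} x≢c₄ = by-cases (lem {ReachesC₄ x})
      where
      open ≡-Reasoning
      by-cases : Dec (ReachesC₄ x) → f₂ lem M (S x) ≡ S (f₂ lem M x)
      by-cases (yes r) = begin
        f₂ lem M (S x)  ≡⟨ f₂-reaching (reaches⇒reaches-S x≢c₄ r) ⟩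
        P (f (S x))     ≡⟨ cong P (f-S-comm x≢c₄) ⟩
        P (S (f x))     ≡⟨ proj₁ (ax8-P (f x)) ⟩
        f x             ≡⟨ sym (proj₂ (ax8-P (f x))) ⟩
        S (P (f x))     ≡⟨ cong S (sym (f₂-reaching r)) ⟩
        S (f₂ lem M x)  ∎
      by-cases (no ¬r) = begin
        f₂ lem M (S x)  ≡⟨ f₂-nonreaching (¬r ∘ reaches-S⇒reaches) ⟩
        f (S x)         ≡⟨ f-S-comm x≢c₄ ⟩
        S (f x)         ≡⟨ cong S (sym (f₂-nonreaching ¬r)) ⟩
        S (f₂ lem M x)  ∎

mainTheorem17 : (lem : ExcludedMiddle 0ℓ) (M₁ : Structure Sym₁) → ModelT₁ M₁ →
    Σ (List (ClosedTerm Sym₁)) λ τs →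
      ∀ (x : Carrier M₁) → x ∉ map (evalClosed (M₂ lem M₁)) τs →
        fnₛ (M₂ lem M₁) sf (fnₛ (M₂ lem M₁) (old sS) x)
          ≡ fnₛ (M₂ lem M₁) (old sS) (fnₛ (M₂ lem M₁) sf x)
mainTheorem17 lem M₁ T = con c₄-index ∷ [] , λ x x∉ → f₂-S-comm M₁ T lem (x∉ ∘ here)
  where c₄-index = suc (suc (suc zero))
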